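{- Let $p\geq 3$ and $m\geq 3p+1$ be integers, and let $n_1,m_1\ge 0$ be integers with $m_1\leq m-p$. Then $\mathrm{ex}(n_1,m_1;P_7)\leq p(n_1-2)+m-p+m_1$, with equality if and only if $n_1=2$ and $m_1=m-p$.
   Context: $P_7$ is the path on $7$ vertices. $\mathrm{ex}(a,b;H)$ is the maximum number of edges in a bipartite graph with parts of sizes $a$ and $b$ containing no subgraph isomorphic to $H$. -}

module Defs where

open import Data.Nat using (ℕ; _+_; _≤_)
open import Data.Fin using (Fin; inject₁; suc)
open import Data.Bool using (Bool; true; false)
open import Data.Sum using (_⊎_; inj₁; inj₂)
open import Data.Product using (Σ; _×_)
open import Data.Empty using (⊥)
open import Data.List using (List; map; allFin; concatMap)
open import Data.Nat.ListAction using (sum)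
open import Relation.Binary.PropositionalEquality using (_≡_)
open import Relation.Nullary using (¬_)
open import Function.Definitions using (Injective)

-- A bipartite graph with parts A = Fin a and B = Fin b, given by its
-- biadjacency matrix: E i j ≡ true iff {i , j} is an edge.
BipGraph : ℕ → ℕ → Set
BipGraph a b = Fin a → Fin b → Bool

Vertex : ℕ → ℕ → Set
Vertex a b = Fin a ⊎ Fin b

Adj : ∀ {a b} → BipGraph a b → Vertex a b → Vertex a b → Set
Adj E (inj₁ i) (inj₂ j) = E i j ≡ true
Adj E (inj₂ j) (inj₁ i) = E i j ≡ true
Adj E (inj₁ _) (inj₁ _) = ⊥
Adj E (inj₂ _) (inj₂ _) = ⊥

bit : Bool → ℕ
bit true  = 1
bit false = 0

edges : ∀ {a b} → BipGraph a b → ℕ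
edges {a} {b} E = sum (concatMap (λ i → map (λ j → bit (E i j)) (allFin b)) (allFin a))

ContainsP7 : ∀ {a b} → BipGraph a b → Set
ContainsP7 {a} {b} E =
  Σ (Fin 7 → Vertex a b) λ f →
    Injective _≡_ _≡_ f × ((i : Fin 6) → Adj E (f (inject₁ i)) (f (suc i)))

P7-free : ∀ {a b} → BipGraph a b → Set
P7-free E = ¬ ContainsP7 E

IsExP7 : ℕ → ℕ → ℕ → Set
IsExP7 a b k =
  Σ (BipGraph a b) (λ E → P7-free E × edges E ≡ k)
  × ((E : BipGraph a b) → P7-free E → edges E ≤ k)

{-# OPTIONS --safe #-}
-- For n₁ ≤ 1, and for m₁ ≤ 3, the trivial bound n₁ m₁ on the number of edges suffices.
-- For n₁ = 2, K₂,ₘ₁ itself is P₇-free (a P₇ has three vertices in each part), so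
-- ex = 2 m₁ and the claim reduces to m₁ ≤ m − p.  For n₁ ≥ 3 and m₁ ≥ 4 a P₇-free graph
-- has at most 2 m₁ + 3 n₁ − 7 edges: delete a row of degree ≤ 3 or a column of degree ≤ 2
-- and induct; if there is none, a P₇ is grown greedily through fresh neighbours.  With
-- three rows, at most three columns meet all rows (four would carry a P₇), and once three
-- do, every other column is isolated.
module Submission where

open import Defs
open import Data.Nat using (ℕ; zero; suc; _≤_; _<_; _+_; _*_; _∸_; z≤n; s≤s; _≤ᵇ_; _≤?_; _≟_)
open import Data.Nat.Properties
open import Data.Nat.Tactic.RingSolver using (solve-∀)
open import Data.Integer using (+_; _-_; +≤+) renaming (_+_ to _+ℤ_; _*_ to _*ℤ_; _≤_ to _≤ℤ_)
open import Data.Integer.Properties using (pos-+; pos-*; +-injective; [+m]-[+n]≡m⊖n; ⊖-≥)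
import Data.Integer.Tactic.RingSolver as ℤ-Solver
open import Data.Fin using (Fin; zero; suc; punchIn; inject₁)
open import Data.Fin.Patterns using (0F; 1F; 2F; 3F; 4F; 5F; 6F)
open import Data.Fin.Properties using (punchInᵢ≢i; punchIn-injective; all?; ¬∀⟶∃¬; injective⇒≤)
  renaming (_≟_ to _≟ᶠ_)
open import Data.Bool using (Bool; true; false; T)
open import Data.Unit using (tt)
open import Data.Empty using (⊥-elim)
open import Data.Product using (∃; _×_; _,_)
open import Data.Sum using (_⊎_; inj₁; inj₂; [_,_]′) renaming (map to ⊎-map)
open import Data.Sum.Properties using (inj₁-injective; inj₂-injective)
open import Data.List using (List; []; _∷_; concatMap; tabulate; map; allFin)
open import Data.List.Properties using (map-tabulate)
import Data.Nat.ListAction as List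
open import Data.Nat.ListAction.Properties using (sum-++)
open import Data.Vec using (Vec; []; _∷_; lookup)
open import Data.Vec.Relation.Unary.All using (All; []; _∷_)
open import Data.Vec.Relation.Unary.AllPairs using ([]; _∷_)
open import Data.Vec.Relation.Unary.Unique.Propositional using (Unique)
open import Data.Vec.Relation.Unary.Unique.Propositional.Properties using (lookup-injective)
open import Algebra.Properties.Semiring.Sum +-*-semiring
  using (sum; sum-syntax; sum-cong-≗; sum-remove; ∑-comm; ∑-distrib-+; *-distribˡ-sum)
open import Function using (id; _∘′_)
open import Function.Bundles using (_⇔_; mk⇔; module Equivalence)
open import Function.Definitions using (Injective)
open import Function.Properties.Equivalence using () renaming (sym to ⇔-sym; trans to ⇔-trans)
open import Relation.Nullary using (yes; no)
open import Relation.Binary.PropositionalEquality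

∑-mono-≤ : ∀ {n} {f g : Fin n → ℕ} → (∀ i → f i ≤ g i) → sum f ≤ sum g
∑-mono-≤ {zero}  f≤g = z≤n
∑-mono-≤ {suc n} f≤g = +-mono-≤ (f≤g zero) (∑-mono-≤ (λ i → f≤g (suc i)))

∑-const : ∀ n c → ∑[ i < n ] c ≡ n * c
∑-const zero    c = refl
∑-const (suc n) c = cong (_+_ c) (∑-const n c)

sum-concatMap : ∀ {A : Set} (f : A → List ℕ) xs → List.sum (concatMap f xs) ≡ List.sum (map (λ x → List.sum (f x)) xs)
sum-concatMap f []       = refl
sum-concatMap f (x ∷ xs) = trans (sum-++ (f x) (concatMap f xs)) (cong (_+_ (List.sum (f x))) (sum-concatMap f xs))

sum-tabulate : ∀ {n} (f : Fin n → ℕ) → List.sum (tabulate f) ≡ sum f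
sum-tabulate {zero}  f = refl
sum-tabulate {suc n} f = cong (_+_ (f zero)) (sum-tabulate (λ i → f (suc i)))

sum-map-allFin : ∀ {n} (f : Fin n → ℕ) → List.sum (map f (allFin n)) ≡ sum f
sum-map-allFin f = trans (cong List.sum (map-tabulate id f)) (sum-tabulate f)

bit≤1 : ∀ x → bit x ≤ 1
bit≤1 true  = s≤s z≤n
bit≤1 false = z≤n

count : ∀ {n} → (Fin n → Bool) → ℕ
count g = ∑[ j < _ ] bit (g j)

count≤ : ∀ {n} (g : Fin n → Bool) → count g ≤ n
count≤ {zero}  g = z≤n
count≤ {suc n} g = +-mono-≤ (bit≤1 (g zero)) (count≤ (λ i → g (suc i)))

n≤count⇒all-true : ∀ {n} (g : Fin n → Bool) → n ≤ count g → ∀ j → g j ≡ true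
n≤count⇒all-true {suc n} g n≤count j with g j in gj
... | true  = refl
... | false = ⊥-elim (<⇒≱ (s≤s (count≤ (λ i → g (punchIn j i)))) (begin
  suc n                              ≤⟨ n≤count ⟩
  count g                            ≡⟨ sum-remove {i = j} (λ i → bit (g i)) ⟩
  bit (g j) + count (λ i → g (punchIn j i)) ≡⟨ cong (λ b → bit b + count (λ i → g (punchIn j i))) gj ⟩
  count (λ i → g (punchIn j i))      ∎))
  where open ≤-Reasoning

all-true⇒count≡n : ∀ {n} (g : Fin n → Bool) → (∀ j → g j ≡ true) → count g ≡ n
all-true⇒count≡n {zero}  g all = refl
all-true⇒count≡n {suc n} g all = cong₂ (λ b c → bit b + c) (all zero) (all-true⇒count≡n (λ i → g (suc i)) (λ i → all (suc i)))

avoiding : ∀ {n} → Fin n → (Fin n → Bool) → Fin n → Bool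
avoiding y g j with j ≟ᶠ y
... | yes _ = false
... | no  _ = g j

avoiding-sound : ∀ {n} y (g : Fin n → Bool) j → avoiding y g j ≡ true → g j ≡ true × j ≢ y
avoiding-sound y g j a with j ≟ᶠ y
... | no j≢y = a , j≢y

count≤suc-count-avoiding : ∀ {n} y (g : Fin (suc n) → Bool) → count g ≤ suc (count (avoiding y g))
count≤suc-count-avoiding y g = begin
  count g                                        ≡⟨ sum-remove {i = y} (λ i → bit (g i)) ⟩
  bit (g y) + count (λ i → g (punchIn y i))      ≤⟨ +-mono-≤ (bit≤1 (g y)) (≤-reflexive (sum-cong-≗ (λ i → cong bit (away i)))) ⟩
  1 + count (λ i → avoiding y g (punchIn y i))   ≤⟨ +-monoʳ-≤ 1 (m≤n+m _ _) ⟩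
  1 + (bit (avoiding y g y) + count (λ i → avoiding y g (punchIn y i))) ≡⟨ cong suc (sum-remove {i = y} (λ i → bit (avoiding y g i))) ⟨
  suc (count (avoiding y g))                     ∎
  where
  open ≤-Reasoning
  away : ∀ i → g (punchIn y i) ≡ avoiding y g (punchIn y i)
  away i with punchIn y i ≟ᶠ y
  ... | yes eq = ⊥-elim (punchInᵢ≢i y i eq)
  ... | no  _  = refl

fresh-true : ∀ {m n} (g : Fin m → Bool) → n < count g → (ys : Vec (Fin m) n) → ∃ λ j → g j ≡ true × All (j ≢_) ys
fresh-true {zero}  g () ys
fresh-true {suc m} g 0<count [] with g zero in g0
... | true  = zero , g0 , []
... | false with fresh-true (λ i → g (suc i)) 0<count []
...   | j , gj , _ = suc j , gj , []
fresh-true {suc m} g n<count (y ∷ ys) with fresh-true (avoiding y g) (≤-pred (≤-trans n<count (count≤suc-count-avoiding y g))) ys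
... | j , aj , j∉ys with avoiding-sound y g j aj
...   | gj , j≢y = j , gj , j≢y ∷ j∉ys

degA : ∀ {a b} → BipGraph a b → Fin a → ℕ
degA E i = count (E i)

degB : ∀ {a b} → BipGraph a b → Fin b → ℕ
degB E j = count (λ i → E i j)

edges≡∑degA : ∀ {a b} (E : BipGraph a b) → edges E ≡ ∑[ i < a ] degA E i
edges≡∑degA {a} {b} E = begin
  edges E                                             ≡⟨ sum-concatMap row (allFin a) ⟩
  List.sum (map (λ i → List.sum (row i)) (allFin a))  ≡⟨ sum-map-allFin (λ i → List.sum (row i)) ⟩
  (∑[ i < a ] List.sum (row i))                       ≡⟨ sum-cong-≗ (λ i → sum-map-allFin (λ j → bit (E i j))) ⟩
  (∑[ i < a ] degA E i)                               ∎
  where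
  open ≡-Reasoning
  row : Fin a → List ℕ
  row i = map (λ j → bit (E i j)) (allFin b)

edges≡∑degB : ∀ {a b} (E : BipGraph a b) → edges E ≡ ∑[ j < b ] degB E j
edges≡∑degB E = trans (edges≡∑degA E) (∑-comm (λ i j → bit (E i j)))

restrict : ∀ {a b a′ b′} → BipGraph a b → (Fin a′ → Fin a) → (Fin b′ → Fin b) → BipGraph a′ b′
restrict E φ ψ i j = E (φ i) (ψ j)

deleteA : ∀ {a b} → BipGraph (suc a) b → Fin (suc a) → BipGraph a b
deleteA E x = restrict E (punchIn x) id

deleteB : ∀ {a b} → BipGraph a (suc b) → Fin (suc b) → BipGraph a b
deleteB E y = restrict E id (punchIn y)

edges-deleteA : ∀ {a b} (E : BipGraph (suc a) b) x → edges E ≡ degA E x + edges (deleteA E x)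
edges-deleteA E x = trans (edges≡∑degA E) (trans (sum-remove {i = x} (degA E)) (cong (_+_ (degA E x)) (sym (edges≡∑degA (deleteA E x)))))

edges-deleteB : ∀ {a b} (E : BipGraph a (suc b)) y → edges E ≡ degB E y + edges (deleteB E y)
edges-deleteB E y = trans (edges≡∑degB E) (trans (sum-remove {i = y} (degB E)) (cong (_+_ (degB E y)) (sym (edges≡∑degB (deleteB E y)))))

⊎-map-injective : ∀ {A B C D : Set} {f : A → C} {g : B → D} → Injective _≡_ _≡_ f → Injective _≡_ _≡_ g →
                  Injective _≡_ _≡_ (⊎-map f g)
⊎-map-injective f-inj g-inj {inj₁ x} {inj₁ y} e = cong inj₁ (f-inj (inj₁-injective e))
⊎-map-injective f-inj g-inj {inj₂ x} {inj₂ y} e = cong inj₂ (g-inj (inj₂-injective e))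

ContainsP7-restrict : ∀ {a b a′ b′} (E : BipGraph a b) {φ : Fin a′ → Fin a} {ψ : Fin b′ → Fin b} →
                      Injective _≡_ _≡_ φ → Injective _≡_ _≡_ ψ → ContainsP7 (restrict E φ ψ) → ContainsP7 E
ContainsP7-restrict E {φ} {ψ} φ-inj ψ-inj (f , f-inj , f-adj) =
  (λ k → embed (f k)) , (λ e → f-inj (⊎-map-injective φ-inj ψ-inj e)) , (λ i → embed-adj (f _) (f _) (f-adj i))
  where
  embed : Vertex _ _ → Vertex _ _
  embed = ⊎-map φ ψ
  embed-adj : ∀ u v → Adj (restrict E φ ψ) u v → Adj E (embed u) (embed v)
  embed-adj (inj₁ _) (inj₂ _) e = e
  embed-adj (inj₂ _) (inj₁ _) e = e

P7-free-deleteA : ∀ {a b} (E : BipGraph (suc a) b) x → P7-free E → P7-free (deleteA E x)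
P7-free-deleteA E x free = free ∘′ ContainsP7-restrict E (punchIn-injective x _ _) id

P7-free-deleteB : ∀ {a b} (E : BipGraph a (suc b)) y → P7-free E → P7-free (deleteB E y)
P7-free-deleteB E y free = free ∘′ ContainsP7-restrict E id (punchIn-injective y _ _)

InA : ∀ {a b} → Vertex a b → Set
InA u = ∃ λ x → inj₁ x ≡ u

InA-before-B : ∀ {a b} (E : BipGraph a b) {u y} → Adj E u (inj₂ y) → InA u
InA-before-B E {inj₁ x} _ = x , refl

InA-two-steps : ∀ {a b} (E : BipGraph a b) {u v w} → Adj E u v → Adj E v w → InA u → InA w
InA-two-steps E {inj₁ _} {inj₂ _} {inj₁ z} _ _  _ = z , refl
InA-two-steps E {inj₁ _} {inj₂ _} {inj₂ _} _ () _

three-in-A⇒3≤a : ∀ {a b} {P : Set} {f : P → Vertex a b} → Injective _≡_ _≡_ f →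
                  ∀ {i j k} → i ≢ j → i ≢ k → j ≢ k → InA (f i) → InA (f j) → InA (f k) → 3 ≤ a
three-in-A⇒3≤a {f = f} f-inj i≢j i≢k j≢k (x , ex) (y , ey) (z , ez) =
  injective⇒≤ (lookup-injective {xs = x ∷ y ∷ z ∷ []}
    ((apart i≢j ex ey ∷ apart i≢k ex ez ∷ []) ∷ (apart j≢k ey ez ∷ []) ∷ [] ∷ []) _ _)
  where
  apart : ∀ {i j x y} → i ≢ j → inj₁ x ≡ f i → inj₁ y ≡ f j → x ≢ y
  apart i≢j ex ey refl = i≢j (f-inj (trans (sym ex) ey))

-- Path vertices alternate between the parts, so positions 1, 3, 5 or 0, 2, 4 lie in Fin a.
ContainsP7⇒3≤a : ∀ {a b} (E : BipGraph a b) → ContainsP7 E → 3 ≤ a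
ContainsP7⇒3≤a E (f , f-inj , f-adj) with f 1F in f1
... | inj₁ x = three-in-A⇒3≤a f-inj {1F} {3F} {5F} (λ ()) (λ ()) (λ ()) A₁ A₃ A₅
  where
  A₁ : InA (f 1F)
  A₁ = x , sym f1
  A₃ : InA (f 3F)
  A₃ = InA-two-steps E (f-adj 1F) (f-adj 2F) A₁
  A₅ : InA (f 5F)
  A₅ = InA-two-steps E (f-adj 3F) (f-adj 4F) A₃
... | inj₂ y = three-in-A⇒3≤a f-inj {0F} {2F} {4F} (λ ()) (λ ()) (λ ()) A₀ A₂ A₄
  where
  A₀ : InA (f 0F)
  A₀ = InA-before-B E (subst (Adj E (f 0F)) f1 (f-adj 0F))
  A₂ : InA (f 2F)
  A₂ = InA-two-steps E (f-adj 0F) (f-adj 1F) A₀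
  A₄ : InA (f 4F)
  A₄ = InA-two-steps E (f-adj 2F) (f-adj 3F) A₂

complete : ∀ a b → BipGraph a b
complete a b _ _ = true

edges-complete : ∀ a b → edges (complete a b) ≡ a * b
edges-complete a b = begin
  edges (complete a b)            ≡⟨ edges≡∑degA (complete a b) ⟩
  (∑[ i < a ] degA (complete a b) i) ≡⟨ sum-cong-≗ (λ i → all-true⇒count≡n (complete a b i) (λ _ → refl)) ⟩
  (∑[ i < a ] b)                  ≡⟨ ∑-const a b ⟩
  a * b                           ∎
  where open ≡-Reasoning

edges≤product : ∀ {a b} (E : BipGraph a b) → edges E ≤ a * b
edges≤product {a} {b} E = begin
  edges E                   ≡⟨ edges≡∑degA E ⟩
  (∑[ i < a ] degA E i)     ≤⟨ ∑-mono-≤ (λ i → count≤ (E i)) ⟩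
  (∑[ i < a ] b)            ≡⟨ ∑-const a b ⟩
  a * b                     ∎
  where open ≤-Reasoning

-- The path b₀ a₀ b₁ a₁ b₂ a₂ b₃.
record Zigzag {a b} (E : BipGraph a b) : Set where
  field
    bs : Vec (Fin b) 4
    as : Vec (Fin a) 3
    bs-unique : Unique bs
    as-unique : Unique as
    edgeˡ : ∀ t → E (lookup as t) (lookup bs (inject₁ t)) ≡ true
    edgeʳ : ∀ t → E (lookup as t) (lookup bs (suc t)) ≡ true

parity : Fin 7 → Fin 4 ⊎ Fin 3
parity 0F = inj₁ 0F
parity 1F = inj₂ 0F
parity 2F = inj₁ 1F
parity 3F = inj₂ 1F
parity 4F = inj₁ 2F
parity 5F = inj₂ 2F
parity 6F = inj₁ 3F

parity⁻¹ : Fin 4 ⊎ Fin 3 → Fin 7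
parity⁻¹ (inj₁ 0F) = 0F
parity⁻¹ (inj₂ 0F) = 1F
parity⁻¹ (inj₁ 1F) = 2F
parity⁻¹ (inj₂ 1F) = 3F
parity⁻¹ (inj₁ 2F) = 4F
parity⁻¹ (inj₂ 2F) = 5F
parity⁻¹ (inj₁ 3F) = 6F

parity⁻¹-parity : ∀ i → parity⁻¹ (parity i) ≡ i
parity⁻¹-parity 0F = refl
parity⁻¹-parity 1F = refl
parity⁻¹-parity 2F = refl
parity⁻¹-parity 3F = refl
parity⁻¹-parity 4F = refl
parity⁻¹-parity 5F = refl
parity⁻¹-parity 6F = refl

parity-injective : Injective _≡_ _≡_ parity
parity-injective {i} {j} e = begin
  i                   ≡⟨ parity⁻¹-parity i ⟨
  parity⁻¹ (parity i) ≡⟨ cong parity⁻¹ e ⟩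
  parity⁻¹ (parity j) ≡⟨ parity⁻¹-parity j ⟩
  j                   ∎
  where open ≡-Reasoning

zigzag⇒P7 : ∀ {a b} {E : BipGraph a b} → Zigzag E → ContainsP7 E
zigzag⇒P7 {a} {b} {E} Z = f , f-injective , f-adj
  where
  open Zigzag Z
  vertex : Fin 4 ⊎ Fin 3 → Vertex a b
  vertex = [ (λ t → inj₂ (lookup bs t)) , (λ t → inj₁ (lookup as t)) ]′
  vertex-injective : Injective _≡_ _≡_ vertex
  vertex-injective {inj₁ s} {inj₁ t} e = cong inj₁ (lookup-injective bs-unique s t (inj₂-injective e))
  vertex-injective {inj₂ s} {inj₂ t} e = cong inj₂ (lookup-injective as-unique s t (inj₁-injective e))
  f : Fin 7 → Vertex a b
  f i = vertex (parity i)
  f-injective : Injective _≡_ _≡_ f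
  f-injective e = parity-injective (vertex-injective e)
  f-adj : ∀ i → Adj E (f (inject₁ i)) (f (suc i))
  f-adj 0F = edgeˡ 0F
  f-adj 1F = edgeʳ 0F
  f-adj 2F = edgeˡ 1F
  f-adj 3F = edgeʳ 1F
  f-adj 4F = edgeˡ 2F
  f-adj 5F = edgeʳ 2F

min-degree⇒zigzag : ∀ {a b} (E : BipGraph a b) → Fin b → (∀ x → 4 ≤ degA E x) → (∀ y → 3 ≤ degB E y) → Zigzag E
-- The path is grown from b₀ and listed backwards, as b₃ a₂ b₂ a₁ b₁ a₀ b₀.
min-degree⇒zigzag E b₀ 4≤degA 3≤degB
  with a₀ , a₀b₀ , _  ← fresh-true (λ i → E i b₀) (≤-trans (s≤s z≤n) (3≤degB b₀)) []
  with b₁ , a₀b₁ , b₁∉ ← fresh-true (E a₀) (≤-trans (s≤s (s≤s z≤n)) (4≤degA a₀)) (b₀ ∷ [])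
  with a₁ , a₁b₁ , a₁∉ ← fresh-true (λ i → E i b₁) (≤-trans (s≤s (s≤s z≤n)) (3≤degB b₁)) (a₀ ∷ [])
  with b₂ , a₁b₂ , b₂∉ ← fresh-true (E a₁) (≤-trans (s≤s (s≤s (s≤s z≤n))) (4≤degA a₁)) (b₁ ∷ b₀ ∷ [])
  with a₂ , a₂b₂ , a₂∉ ← fresh-true (λ i → E i b₂) (3≤degB b₂) (a₁ ∷ a₀ ∷ [])
  with b₃ , a₂b₃ , b₃∉ ← fresh-true (E a₂) (4≤degA a₂) (b₂ ∷ b₁ ∷ b₀ ∷ [])
  = record
  { bs = b₃ ∷ b₂ ∷ b₁ ∷ b₀ ∷ []
  ; as = a₂ ∷ a₁ ∷ a₀ ∷ []
  ; bs-unique = b₃∉ ∷ b₂∉ ∷ b₁∉ ∷ [] ∷ []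
  ; as-unique = a₂∉ ∷ a₁∉ ∷ [] ∷ []
  ; edgeˡ = λ { 0F → a₂b₃ ; 1F → a₁b₂ ; 2F → a₀b₁ }
  ; edgeʳ = λ { 0F → a₂b₂ ; 1F → a₁b₁ ; 2F → a₀b₀ }
  }

module ThreeRows {m} (E : BipGraph 3 m) (free : P7-free E) where

  full : Fin m → Bool
  full j = 3 ≤ᵇ degB E j

  full-adj : ∀ {j} → full j ≡ true → ∀ i → E i j ≡ true
  full-adj {j} fj = n≤count⇒all-true (λ i → E i j) (≤ᵇ⇒≤ 3 (degB E j) (subst T (sym fj) tt))

  non-full-deg : ∀ {j} → full j ≡ false → degB E j ≤ 2
  non-full-deg fj = ≤-pred (≰⇒> (λ 3≤deg → subst T fj (≤⇒≤ᵇ 3≤deg)))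

  non-full≢full : ∀ {j y} → full j ≡ false → full y ≡ true → j ≢ y
  non-full≢full fj fy refl with () ← trans (sym fj) fy

  #full : ℕ
  #full = count full

  #full≤3 : #full ≤ 3
  #full≤3 = ≮⇒≥ λ 3<#full → free (zigzag⇒P7 (four-full 3<#full))
    where
    four-full : 3 < #full → Zigzag E
    four-full 3<#full
      with b₀ , f₀ , _   ← fresh-true full (≤-trans (s≤s z≤n) 3<#full) []
      with b₁ , f₁ , b₁∉ ← fresh-true full (≤-trans (s≤s (s≤s z≤n)) 3<#full) (b₀ ∷ [])
      with b₂ , f₂ , b₂∉ ← fresh-true full (≤-trans (s≤s (s≤s (s≤s z≤n))) 3<#full) (b₁ ∷ b₀ ∷ [])
      with b₃ , f₃ , b₃∉ ← fresh-true full 3<#full (b₂ ∷ b₁ ∷ b₀ ∷ [])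
      = record
      { bs = b₃ ∷ b₂ ∷ b₁ ∷ b₀ ∷ []
      ; as = 0F ∷ 1F ∷ 2F ∷ []
      ; bs-unique = b₃∉ ∷ b₂∉ ∷ b₁∉ ∷ [] ∷ []
      ; as-unique = ((λ ()) ∷ (λ ()) ∷ []) ∷ ((λ ()) ∷ []) ∷ [] ∷ []
      ; edgeˡ = λ { 0F → full-adj f₃ 0F ; 1F → full-adj f₂ 1F ; 2F → full-adj f₁ 2F }
      ; edgeʳ = λ { 0F → full-adj f₂ 0F ; 1F → full-adj f₁ 1F ; 2F → full-adj f₀ 2F }
      }

  non-full-isolated : 2 < #full → ∀ {j} → full j ≡ false → degB E j ≡ 0
  non-full-isolated 2<#full {j} fj = n≤0⇒n≡0 (≮⇒≥ λ 0<deg → free (zigzag⇒P7 (through-j 0<deg)))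
    where
    through-j : 0 < degB E j → Zigzag E
    through-j 0<deg
      with a , aj , _     ← fresh-true (λ i → E i j) 0<deg []
      with b₀ , f₀ , _   ← fresh-true full (≤-trans (s≤s z≤n) 2<#full) []
      with b₁ , f₁ , b₁∉ ← fresh-true full (≤-trans (s≤s (s≤s z≤n)) 2<#full) (b₀ ∷ [])
      with b₂ , f₂ , b₂∉ ← fresh-true full 2<#full (b₁ ∷ b₀ ∷ [])
      = record
      { bs = j ∷ b₂ ∷ b₁ ∷ b₀ ∷ []
      ; as = a ∷ punchIn a 0F ∷ punchIn a 1F ∷ []
      ; bs-unique = (non-full≢full fj f₂ ∷ non-full≢full fj f₁ ∷ non-full≢full fj f₀ ∷ []) ∷ b₂∉ ∷ b₁∉ ∷ [] ∷ []
      ; as-unique = (punchInᵢ≢i a 0F ∘′ sym ∷ punchInᵢ≢i a 1F ∘′ sym ∷ [])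
                  ∷ ((λ ()) ∘′ punchIn-injective a 0F 1F ∷ []) ∷ [] ∷ []
      ; edgeˡ = λ { 0F → aj ; 1F → full-adj f₂ _ ; 2F → full-adj f₁ _ }
      ; edgeʳ = λ { 0F → full-adj f₂ _ ; 1F → full-adj f₁ _ ; 2F → full-adj f₀ _ }
      }

  edges-bound : 4 ≤ m → edges E + 7 ≤ 2 * m + 9
  edges-bound 4≤m with #full ≤? 2
  ... | yes #full≤2 = begin
    edges E + 7                       ≡⟨ cong (_+ 7) (edges≡∑degB E) ⟩
    (∑[ j < m ] degB E j) + 7         ≤⟨ +-monoˡ-≤ 7 (∑-mono-≤ deg≤2+full) ⟩
    (∑[ j < m ] (2 + bit (full j))) + 7 ≡⟨ cong (_+ 7) (∑-distrib-+ (λ _ → 2) (λ j → bit (full j))) ⟩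
    (∑[ j < m ] 2) + #full + 7        ≡⟨ cong (λ s → s + #full + 7) (trans (∑-const m 2) (*-comm m 2)) ⟩
    2 * m + #full + 7                 ≤⟨ +-monoˡ-≤ 7 (+-monoʳ-≤ (2 * m) #full≤2) ⟩
    2 * m + 2 + 7                     ≡⟨ +-assoc (2 * m) 2 7 ⟩
    2 * m + 9                         ∎
    where
    open ≤-Reasoning
    deg≤2+full : ∀ j → degB E j ≤ 2 + bit (full j)
    deg≤2+full j with full j in fj
    ... | true  = count≤ (λ i → E i j)
    ... | false = ≤-trans (non-full-deg fj) (≤-reflexive (sym (+-identityʳ 2)))
  ... | no #full≰2 = begin
    edges E + 7                       ≡⟨ cong (_+ 7) (edges≡∑degB E) ⟩
    (∑[ j < m ] degB E j) + 7         ≤⟨ +-monoˡ-≤ 7 (∑-mono-≤ deg≤3*full) ⟩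
    (∑[ j < m ] (3 * bit (full j))) + 7 ≡⟨ cong (_+ 7) (*-distribˡ-sum 3 (λ j → bit (full j))) ⟨
    3 * #full + 7                     ≤⟨ +-monoˡ-≤ 7 (*-monoʳ-≤ 3 #full≤3) ⟩
    16                                ≤⟨ <⇒≤ (+-monoˡ-≤ 9 (*-monoʳ-≤ 2 4≤m)) ⟩
    2 * m + 9                         ∎
    where
    open ≤-Reasoning
    deg≤3*full : ∀ j → degB E j ≤ 3 * bit (full j)
    deg≤3*full j with full j in fj
    ... | true  = count≤ (λ i → E i j)
    ... | false = ≤-reflexive (non-full-isolated (≰⇒> #full≰2) fj)

P7-free-edges-bound : ∀ r s (E : BipGraph (3 + r) (4 + s)) → P7-free E → edges E + 7 ≤ 2 * (4 + s) + 3 * (3 + r)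
P7-free-edges-bound zero    s E free = ThreeRows.edges-bound E free (m≤m+n 4 s)
P7-free-edges-bound (suc r) s E free with all? (λ x → 4 ≤? degA E x)
... | no ¬high with x , ¬4≤deg ← ¬∀⟶∃¬ _ _ (λ x → 4 ≤? degA E x) ¬high = begin
  edges E + 7                          ≡⟨ cong (_+ 7) (edges-deleteA E x) ⟩
  degA E x + edges (deleteA E x) + 7   ≡⟨ +-assoc (degA E x) _ 7 ⟩
  degA E x + (edges (deleteA E x) + 7) ≤⟨ +-mono-≤ (≤-pred (≰⇒> ¬4≤deg)) (P7-free-edges-bound r s (deleteA E x) (P7-free-deleteA E x free)) ⟩
  3 + (2 * (4 + s) + 3 * (3 + r))      ≡⟨ shift r s ⟩
  2 * (4 + s) + 3 * (3 + suc r)        ∎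
  where
  open ≤-Reasoning
  shift : ∀ r s → 3 + (2 * (4 + s) + 3 * (3 + r)) ≡ 2 * (4 + s) + 3 * (3 + suc r)
  shift = solve-∀
... | yes 4≤degA with s
...   | zero = ⊥-elim (free (zigzag⇒P7 (min-degree⇒zigzag E zero 4≤degA 3≤degB)))
  where
  3≤degB : ∀ y → 3 ≤ degB E y
  3≤degB y = ≤-trans (m≤m+n 3 (suc r))
    (≤-reflexive (sym (all-true⇒count≡n (λ x → E x y) (λ x → n≤count⇒all-true (E x) (4≤degA x) y))))
...   | suc s with all? (λ y → 3 ≤? degB E y)
...     | yes 3≤degB = ⊥-elim (free (zigzag⇒P7 (min-degree⇒zigzag E zero 4≤degA 3≤degB)))
...     | no ¬high with y , ¬3≤deg ← ¬∀⟶∃¬ _ _ (λ y → 3 ≤? degB E y) ¬high = begin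
  edges E + 7                          ≡⟨ cong (_+ 7) (edges-deleteB E y) ⟩
  degB E y + edges (deleteB E y) + 7   ≡⟨ +-assoc (degB E y) _ 7 ⟩
  degB E y + (edges (deleteB E y) + 7) ≤⟨ +-mono-≤ (≤-pred (≰⇒> ¬3≤deg)) (P7-free-edges-bound (suc r) s (deleteB E y) (P7-free-deleteB E y free)) ⟩
  2 + (2 * (4 + s) + 3 * (3 + suc r))  ≡⟨ shift r s ⟩
  2 * (4 + suc s) + 3 * (3 + suc r)    ∎
  where
  open ≤-Reasoning
  shift : ∀ r s → 2 + (2 * (4 + s) + 3 * (3 + suc r)) ≡ 2 * (4 + suc s) + 3 * (3 + suc r)
  shift = solve-∀

ex≤product : ∀ {a b k} → IsExP7 a b k → k ≤ a * b
ex≤product ((E , _ , refl) , _) = edges≤product E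

ex-two-rows : ∀ {b k} → IsExP7 2 b k → k ≡ 2 * b
ex-two-rows {b} ex@(_ , maximal) = ≤-antisym (ex≤product ex)
  (subst (_≤ _) (edges-complete 2 b) (maximal (complete 2 b) (λ P → <⇒≱ (s≤s (s≤s (s≤s z≤n))) (ContainsP7⇒3≤a _ P))))

ex-P7-bound : ∀ {r s k} → IsExP7 (3 + r) (4 + s) k → k + 7 ≤ 2 * (4 + s) + 3 * (3 + r)
ex-P7-bound {r} {s} ((E , free , refl) , _) = P7-free-edges-bound r s E free

3n+2p≤pn+6 : ∀ {p n} → 3 ≤ p → 2 ≤ n → 3 * n + 2 * p ≤ p * n + 6
3n+2p≤pn+6 {p} {n} 3≤p 2≤n
  with w , refl ← m≤n⇒∃[o]m+o≡n 3≤p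
  with v , refl ← m≤n⇒∃[o]m+o≡n 2≤n
  = begin
  3 * (2 + v) + 2 * (3 + w)             ≤⟨ m≤m+n _ (w * v) ⟩
  3 * (2 + v) + 2 * (3 + w) + w * v     ≡⟨ expand w v ⟩
  (3 + w) * (2 + v) + 6                 ∎
  where
  open ≤-Reasoning
  expand : ∀ w v → 3 * (2 + v) + 2 * (3 + w) + w * v ≡ (3 + w) * (2 + v) + 6
  expand = solve-∀

module _ {k p m n m₁ : ℕ} (3p<m : 3 * p < m) where
  open ≤-Reasoning

  below-from-few-columns : k ≤ m₁ → k + 3 * p < p * n + m + m₁
  below-from-few-columns k≤m₁ = begin-strict
    k + 3 * p         ≤⟨ +-monoˡ-≤ (3 * p) k≤m₁ ⟩
    m₁ + 3 * p        <⟨ +-monoʳ-< m₁ 3p<m ⟩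
    m₁ + m            ≡⟨ +-comm m₁ m ⟩
    m + m₁            ≤⟨ m≤n+m (m + m₁) (p * n) ⟩
    p * n + (m + m₁)  ≡⟨ +-assoc (p * n) m m₁ ⟨
    p * n + m + m₁    ∎

  below-from-few-rows : 3 ≤ p → k ≤ 3 * n → k + 3 * p < p * n + m + m₁
  below-from-few-rows 3≤p k≤3n = begin-strict
    k + 3 * p         ≤⟨ +-monoˡ-≤ (3 * p) (≤-trans k≤3n (*-monoˡ-≤ n 3≤p)) ⟩
    p * n + 3 * p     <⟨ +-monoʳ-< (p * n) 3p<m ⟩
    p * n + m         ≤⟨ m≤m+n (p * n + m) m₁ ⟩
    p * n + m + m₁    ∎

below-from-P7-bound : ∀ {k p m n m₁} → 3 ≤ p → 2 ≤ n → m₁ + p ≤ m →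
                      k + 7 ≤ 2 * m₁ + 3 * n → k + 3 * p < p * n + m + m₁
below-from-P7-bound {k} {p} {m} {n} {m₁} 3≤p 2≤n m₁+p≤m k+7≤ = +-cancelʳ-≤ 6 _ _ (begin
  suc (k + 3 * p) + 6               ≡⟨ regroupₗ k p ⟩
  k + 7 + 3 * p                     ≤⟨ +-monoˡ-≤ (3 * p) k+7≤ ⟩
  2 * m₁ + 3 * n + 3 * p            ≡⟨ regroupₘ m₁ n p ⟩
  m₁ + (m₁ + p) + (3 * n + 2 * p)   ≤⟨ +-mono-≤ (+-monoʳ-≤ m₁ m₁+p≤m) (3n+2p≤pn+6 3≤p 2≤n) ⟩
  m₁ + m + (p * n + 6)              ≡⟨ regroupᵣ m₁ m (p * n) ⟩
  p * n + m + m₁ + 6                ∎)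
  where
  open ≤-Reasoning
  regroupₗ : ∀ k p → suc (k + 3 * p) + 6 ≡ k + 7 + 3 * p
  regroupₗ = solve-∀
  regroupₘ : ∀ m₁ n p → 2 * m₁ + 3 * n + 3 * p ≡ m₁ + (m₁ + p) + (3 * n + 2 * p)
  regroupₘ = solve-∀
  regroupᵣ : ∀ m₁ m q → m₁ + m + (q + 6) ≡ q + m + m₁ + 6
  regroupᵣ = solve-∀

below-target : ∀ {p m k} n₁ m₁ → 3 ≤ p → 3 * p < m → m₁ + p ≤ m → n₁ ≢ 2 → IsExP7 n₁ m₁ k →
               k + 3 * p < p * n₁ + m + m₁
below-target {p} 0 m₁ _ 3p<m _ _ ex = below-from-few-columns {p = p} {n = 0} 3p<m (≤-trans (ex≤product ex) z≤n)
below-target {p} 1 m₁ _ 3p<m _ _ ex = below-from-few-columns {p = p} {n = 1} 3p<m (≤-trans (ex≤product ex) (≤-reflexive (*-identityˡ m₁)))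
below-target 2 m₁ _ _ _ n₁≢2 _ = ⊥-elim (n₁≢2 refl)
below-target (suc (suc (suc r))) m₁ 3≤p 3p<m m₁+p≤m _ ex with m₁ ≤? 3
... | yes m₁≤3 = below-from-few-rows 3p<m 3≤p (≤-trans (ex≤product ex) (≤-trans (*-monoʳ-≤ (3 + r) m₁≤3) (≤-reflexive (*-comm (3 + r) 3))))
... | no m₁≰3 with s , refl ← m≤n⇒∃[o]m+o≡n (≰⇒> m₁≰3) = below-from-P7-bound 3≤p (s≤s (s≤s z≤n)) m₁+p≤m (ex-P7-bound ex)

+≡⇔≡∸ : ∀ {k c n} → c ≤ n → (k + c ≡ n) ⇔ (k ≡ n ∸ c)
+≡⇔≡∸ {k} {c} c≤n = mk⇔ (λ eq → trans (sym (m+n∸n≡m k c)) (cong (_∸ c) eq))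
                         (λ eq → trans (cong (_+ c) eq) (m∸n+n≡m c≤n))

two-rows-target : ∀ {p m m₁ k} → m₁ + p ≤ m → IsExP7 2 m₁ k →
                  (k + 3 * p ≤ p * 2 + m + m₁) × ((k + 3 * p ≡ p * 2 + m + m₁) ⇔ (m₁ ≡ m ∸ p))
two-rows-target {p} {m} {m₁} m₁+p≤m ex rewrite ex-two-rows ex =
  subst₂ _≤_ (sym (lhs m₁ p)) (sym (rhs p m m₁)) (+-monoˡ-≤ (m₁ + 2 * p) m₁+p≤m) ,
  ⇔-trans (mk⇔ (λ eq → +-cancelʳ-≡ (m₁ + 2 * p) _ _ (trans (sym (lhs m₁ p)) (trans eq (rhs p m m₁))))
               (λ eq → trans (lhs m₁ p) (trans (cong (_+ (m₁ + 2 * p)) eq) (sym (rhs p m m₁)))))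
          (+≡⇔≡∸ (≤-trans (m≤n+m p m₁) m₁+p≤m))
  where
  lhs : ∀ m₁ p → 2 * m₁ + 3 * p ≡ m₁ + p + (m₁ + 2 * p)
  lhs = solve-∀
  rhs : ∀ p m m₁ → p * 2 + m + m₁ ≡ m + (m₁ + 2 * p)
  rhs = solve-∀

ex-target : ∀ {p m n₁ m₁ k} → 3 ≤ p → 3 * p < m → m₁ + p ≤ m → IsExP7 n₁ m₁ k →
            (k + 3 * p ≤ p * n₁ + m + m₁) × ((k + 3 * p ≡ p * n₁ + m + m₁) ⇔ (n₁ ≡ 2 × m₁ ≡ m ∸ p))
ex-target {p} {m} {n₁} {m₁} {k} 3≤p 3p<m m₁+p≤m ex with n₁ ≟ 2
... | no n₁≢2 = <⇒≤ below , mk⇔ (λ eq → ⊥-elim (<⇒≢ below eq)) (λ (n₁≡2 , _) → ⊥-elim (n₁≢2 n₁≡2))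
  where
  below : k + 3 * p < p * n₁ + m + m₁
  below = below-target n₁ m₁ 3≤p 3p<m m₁+p≤m n₁≢2 ex
... | yes refl with le , tight ← two-rows-target m₁+p≤m ex =
  le , mk⇔ (λ eq → refl , Equivalence.to tight eq) (λ (_ , eq) → Equivalence.from tight eq)

target≡ : ∀ p n₁ m m₁ → + p *ℤ (+ n₁ - + 2) +ℤ + m - + p +ℤ + m₁ ≡ + (p * n₁ + m + m₁) - + (3 * p)
target≡ p n₁ m m₁ = begin
  + p *ℤ (+ n₁ - + 2) +ℤ + m - + p +ℤ + m₁     ≡⟨ regroup (+ p) (+ n₁) (+ m) (+ m₁) ⟩
  + p *ℤ + n₁ +ℤ + m +ℤ + m₁ - + 3 *ℤ + p      ≡⟨ cong₂ _-_ (sym pos-sum) (sym (pos-* 3 p)) ⟩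
  + (p * n₁ + m + m₁) - + (3 * p)              ∎
  where
  open ≡-Reasoning
  regroup : ∀ P N M M₁ → P *ℤ (N - + 2) +ℤ M - P +ℤ M₁ ≡ P *ℤ N +ℤ M +ℤ M₁ - + 3 *ℤ P
  regroup = ℤ-Solver.solve-∀
  pos-sum : + (p * n₁ + m + m₁) ≡ + p *ℤ + n₁ +ℤ + m +ℤ + m₁
  pos-sum = trans (pos-+ (p * n₁ + m) m₁) (cong (_+ℤ + m₁) (trans (pos-+ (p * n₁) m) (cong (_+ℤ + m) (pos-* p n₁))))

pos-≤-minus : ∀ {k c n} → k + c ≤ n → (+ k ≤ℤ + n - + c) × ((+ k ≡ + n - + c) ⇔ (k + c ≡ n))
pos-≤-minus {k} {c} {n} k+c≤n = subst (λ t → (+ k ≤ℤ t) × ((+ k ≡ t) ⇔ (k + c ≡ n))) (sym difference)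
  (+≤+ (m+n≤o⇒m≤o∸n k k+c≤n) , ⇔-trans (mk⇔ +-injective (cong (λ n → + n))) (⇔-sym (+≡⇔≡∸ c≤n)))
  where
  c≤n : c ≤ n
  c≤n = ≤-trans (m≤n+m c k) k+c≤n
  difference : + n - + c ≡ + (n ∸ c)
  difference = trans ([+m]-[+n]≡m⊖n n c) (⊖-≥ c≤n)

lemma2p2 : (p m n₁ m₁ : ℕ) → 3 ≤ p → 3 * p + 1 ≤ m → m₁ ≤ m ∸ p →
    (k : ℕ) → IsExP7 n₁ m₁ k →
      (+ k ≤ℤ + p *ℤ (+ n₁ - + 2) +ℤ + m - + p +ℤ + m₁)
      × ((+ k ≡ + p *ℤ (+ n₁ - + 2) +ℤ + m - + p +ℤ + m₁) ⇔ (n₁ ≡ 2 × m₁ ≡ m ∸ p))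
lemma2p2 p m n₁ m₁ 3≤p 3p+1≤m m₁≤m∸p k ex =
  let below , tight     = ex-target 3≤p 3p<m m₁+p≤m ex
      ℤ-below , ℤ-tight = pos-≤-minus below
  in subst (λ t → (+ k ≤ℤ t) × ((+ k ≡ t) ⇔ (n₁ ≡ 2 × m₁ ≡ m ∸ p))) (sym (target≡ p n₁ m m₁))
       (ℤ-below , ⇔-trans ℤ-tight tight)
  where
  3p<m : 3 * p < m
  3p<m = subst (_≤ m) (+-comm (3 * p) 1) 3p+1≤m
  m₁+p≤m : m₁ + p ≤ m
  m₁+p≤m = ≤-trans (+-monoˡ-≤ p m₁≤m∸p) (≤-reflexive (m∸n+n≡m (≤-trans (m≤n*m p 3) (<⇒≤ 3p<m))))
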